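{- Let $k\ge1$ be an integer and let $G=(V,E)$ be a bipartite graph. Set $G_0=G$ and, for $i=1,\dots,k$, let $M^{(i)}$ be an arbitrary maximum-cardinality matching of $G_{i-1}$ and let $G_i$ be obtained from $G_{i-1}$ by deleting the edges of $M^{(i)}$ (keeping all vertices). Let $\mathcal{M}_k=M^{(1)}\cup\cdots\cup M^{(k)}$, let $I_k$ be a maximum independent set of $G_k$, let $I^*_k$ be an arbitrary maximum-cardinality $k$-dependent set of $G$, and let $E'_k=E(G[I^*_k])\setminus\mathcal{M}_k$, where $E(G[I^*_k])$ is the edge set of the subgraph of $G$ induced by $I^*_k$. Then $$|I_k|\ge \frac{|I^*_k|}{2}+\frac{|E'_k|}{k}.$$
   Context: All graphs are simple and undirected. For an integer $k\ge0$, a subset $S\subseteq V$ is a $k$-dependent set of $G$ if every vertex has degree at most $k$ in the induced subgraph $G[S]$. -}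

module Defs where

open import Data.Nat using (ℕ; zero; suc; _+_; _*_; _≤_; _<ᵇ_)
open import Data.Bool using (Bool; true; false; _∧_; _∨_; not; if_then_else_)
open import Data.Fin using (Fin; toℕ)
open import Data.Fin.Subset using (Subset; _∈_; ∣_∣)
open import Data.Vec using (lookup)
open import Data.List using (List; []; _∷_; map; allFin)
open import Data.Nat.ListAction using (sum)
open import Data.Product using (Σ; _×_)
open import Relation.Binary.PropositionalEquality using (_≡_; _≢_)

record Graph (n : ℕ) : Set where
  field
    adj    : Fin n → Fin n → Bool
    sym    : ∀ i j → adj i j ≡ adj j i
    irrefl : ∀ i → adj i i ≡ false
open Graph public

countV : {n : ℕ} → (Fin n → Bool) → ℕ
countV {n} f = sum (map (λ j → if f j then 1 else 0) (allFin n))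

countPairs : {n : ℕ} → (Fin n → Fin n → Bool) → ℕ
countPairs {n} f =
  sum (map (λ i → countV (λ j → (toℕ i <ᵇ toℕ j) ∧ f i j)) (allFin n))

numEdges : {n : ℕ} → Graph n → ℕ
numEdges H = countPairs (adj H)

degree : {n : ℕ} → Graph n → Fin n → ℕ
degree H v = countV (adj H v)

Bipartite : {n : ℕ} → Graph n → Set
Bipartite {n} G = Σ (Fin n → Bool) λ c → ∀ i j → adj G i j ≡ true → c i ≢ c j

_⊆G_ : {n : ℕ} → Graph n → Graph n → Set
M ⊆G G = ∀ i j → adj M i j ≡ true → adj G i j ≡ true

IsMatching : {n : ℕ} → Graph n → Graph n → Set
IsMatching G M = (M ⊆G G) × (∀ v → degree M v ≤ 1)

IsMaximumMatching : {n : ℕ} → Graph n → Graph n → Set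
IsMaximumMatching G M =
  IsMatching G M × (∀ M' → IsMatching G M' → numEdges M' ≤ numEdges M)

deleteEdges : {n : ℕ} → Graph n → Graph n → Graph n
deleteEdges G M = record
  { adj = λ i j → adj G i j ∧ not (adj M i j)
  ; sym = λ i j → cong2 (λ a b → a ∧ not b) (sym G i j) (sym M i j)
  ; irrefl = λ i → cong1 (λ a → a ∧ not (adj M i i)) (irrefl G i)
  }
  where
  open import Relation.Binary.PropositionalEquality using () renaming (cong₂ to cong2; cong to cong1)

residual : {n : ℕ} → Graph n → List (Graph n) → Graph n
residual G []       = G
residual G (M ∷ Ms) = residual (deleteEdges G M) Ms

data Peeling {n : ℕ} : Graph n → List (Graph n) → Set where
  done : ∀ {G} → Peeling G []
  step : ∀ {G M Ms} → IsMaximumMatching G M → Peeling (deleteEdges G M) Ms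
       → Peeling G (M ∷ Ms)

unionAdj : {n : ℕ} → List (Graph n) → Fin n → Fin n → Bool
unionAdj []       i j = false
unionAdj (M ∷ Ms) i j = adj M i j ∨ unionAdj Ms i j

_∈ᵇ_ : {n : ℕ} → Fin n → Subset n → Bool
i ∈ᵇ S = lookup S i

IsIndependent : {n : ℕ} → Graph n → Subset n → Set
IsIndependent H S = ∀ i j → i ∈ S → j ∈ S → adj H i j ≡ false

IsMaximumIndependent : {n : ℕ} → Graph n → Subset n → Set
IsMaximumIndependent H S =
  IsIndependent H S × (∀ S' → IsIndependent H S' → ∣ S' ∣ ≤ ∣ S ∣)

inducedDegree : {n : ℕ} → Graph n → Subset n → Fin n → ℕ
inducedDegree G S v = countV (λ j → (j ∈ᵇ S) ∧ adj G v j)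

IsKDependent : {n : ℕ} → ℕ → Graph n → Subset n → Set
IsKDependent k G S = ∀ v → v ∈ S → inducedDegree G S v ≤ k

IsMaximumKDependent : {n : ℕ} → ℕ → Graph n → Subset n → Set
IsMaximumKDependent k G S =
  IsKDependent k G S × (∀ S' → IsKDependent k G S' → ∣ S' ∣ ≤ ∣ S ∣)

numEdgesOutside : {n : ℕ} → Graph n → Subset n → List (Graph n) → ℕ
numEdgesOutside G S Ms =
  countPairs (λ i j → (i ∈ᵇ S) ∧ (j ∈ᵇ S) ∧ adj G i j ∧ not (unionAdj Ms i j))

-- Let R = G_k be the residual graph. By Kőnig's theorem R has a matching N and a vertex cover C
-- with |C| ≤ |N|. The complement of C is independent in R, so n ≤ |C| + |I_k|; and each M⁽ⁱ⁾ is a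
-- maximum matching of a supergraph of R, so k|C| ≤ k|N| ≤ Σᵢ |M⁽ⁱ⁾|. Double counting the edges at
-- each vertex gives k|I*| + 2|E′| + 2 Σᵢ |M⁽ⁱ⁾| ≤ 2kn: a vertex of I* meets at most k edges of
-- G[I*] and otherwise only matching edges leaving I*, any other vertex meets at most k matching
-- edges, and at most k|V ∖ I*| matching edges leave I*. Hence k|I*| + 2|E′| ≤ 2k(n − |C|) ≤ 2k|I_k|.
--
-- Kőnig's theorem is proved by well-founded induction on the number of non-isolated vertices and
-- then the number of edges. Take a non-isolated vertex u: if u is a leaf, match it to its
-- neighbour; if u has exactly two neighbours v and w, contract the path v–u–w; otherwise follow
-- Rizzi's argument with the graphs H − v and H − uw for two neighbours v, w of u.

module Submission where

open import Defs hiding (sym)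
open import Data.Nat using (ℕ; zero; suc; _+_; _*_; _≤_; _<_; _<ᵇ_; z≤n; s≤s)
open import Data.Nat.Properties hiding (_≟_)
open import Data.Nat.Induction using (<-wellFounded)
open import Data.Nat.ListAction as List using ()
open import Data.Nat.Solver using (module +-*-Solver)
open import Data.Bool as Bool using (Bool; true; false; _∧_; _∨_; not; if_then_else_)
open import Data.Bool.Properties using (¬-not; ∧-comm; ∨-comm; ∧-zeroʳ; ∨-zeroʳ; ∧-identityʳ; ∨-identityʳ)
open import Data.Fin using (Fin; toℕ; _≟_) renaming (zero to fzero; suc to fsuc)
open import Data.Fin.Properties using (any?; toℕ-injective)
open import Data.Fin.Subset using (Subset; ∣_∣; _∈_)
open import Data.List using (List; []; _∷_; length; map; allFin; tabulate)
open import Data.List.Properties using (map-tabulate)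
import Data.Vec as Vec
open import Data.Vec using ([]; _∷_)
open import Data.Vec.Properties using (lookup∘tabulate; []=⇒lookup; lookup⇒[]=)
open import Data.Product using (Σ; ∃; _×_; _,_; proj₁; proj₂)
open import Data.Product.Relation.Binary.Lex.Strict using (×-Lex; ×-wellFounded)
open import Data.Sum as Sum using (_⊎_; inj₁; inj₂)
open import Data.Empty using (⊥; ⊥-elim)
open import Function using (_∘_; _on_; id; case_of_)
open import Induction.WellFounded using (WellFounded; module All)
open import Relation.Nullary using (Dec; does; yes; no)
open import Relation.Nullary.Decidable using (dec-true; dec-false; _×-dec_; ¬?)
open import Relation.Binary.Definitions using (tri<; tri≈; tri>)
open import Relation.Binary.Construct.On as On using ()
open import Relation.Binary.PropositionalEquality
open import Algebra.Properties.Semiring.Sum +-*-semiring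
  using (sum; sum-syntax; sum-cong-≗; ∑-distrib-+; ∑-comm; *-distribˡ-sum; sum-replicate-zero)

private variable n : ℕ

-- Finite sums and counting

false≢true : false ≢ true
false≢true ()

𝟙 : Bool → ℕ
𝟙 b = if b then 1 else 0

_≡ᵇ_ : Fin n → Fin n → Bool
i ≡ᵇ j = does (i ≟ j)

≡ᵇ-refl : (i : Fin n) → (i ≡ᵇ i) ≡ true
≡ᵇ-refl i = dec-true (i ≟ i) refl

≡ᵇ-≢ : {i j : Fin n} → i ≢ j → (i ≡ᵇ j) ≡ false
≡ᵇ-≢ {i = i} {j} = dec-false (i ≟ j)

∑-mono-≤ : {f g : Fin n → ℕ} → (∀ i → f i ≤ g i) → sum f ≤ sum g
∑-mono-≤ {zero}  f≤g = z≤n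
∑-mono-≤ {suc n} f≤g = +-mono-≤ (f≤g fzero) (∑-mono-≤ (f≤g ∘ fsuc))

∑-mono-< : {f g : Fin n → ℕ} → (∀ i → f i ≤ g i) → ∀ x → f x < g x → sum f < sum g
∑-mono-< f≤g fzero    fx<gx = +-mono-<-≤ fx<gx (∑-mono-≤ (f≤g ∘ fsuc))
∑-mono-< f≤g (fsuc x) fx<gx = +-mono-≤-< (f≤g fzero) (∑-mono-< (f≤g ∘ fsuc) x fx<gx)

∑-at : (v : Fin n) (g : Fin n → ℕ) → ∑[ i < n ] (if i ≡ᵇ v then g i else 0) ≡ g v
∑-at {suc n} fzero    g = trans (cong (g fzero +_) (sum-replicate-zero n)) (+-identityʳ (g fzero))
∑-at {suc n} (fsuc v) g = ∑-at v (g ∘ fsuc)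

∑-const : ∀ n (c : ℕ) → ∑[ i < n ] c ≡ n * c
∑-const zero    c = refl
∑-const (suc n) c = cong (c +_) (∑-const n c)

∑-if : (b : Bool) (f : Fin n → ℕ) → ∑[ i < n ] (if b then f i else 0) ≡ (if b then sum f else 0)
∑-if {n} true  f = refl
∑-if {n} false f = sum-replicate-zero n

∑∑-cong : {f g : Fin n → Fin n → ℕ} → (∀ i j → f i j ≡ g i j) →
          ∑[ i < n ] ∑[ j < n ] f i j ≡ ∑[ i < n ] ∑[ j < n ] g i j
∑∑-cong {n} f≡g = sum-cong-≗ {n} (λ i → sum-cong-≗ {n} (f≡g i))

∑∑-distrib-+ : (f g : Fin n → Fin n → ℕ) →
               ∑[ i < n ] ∑[ j < n ] (f i j + g i j) ≡ ∑[ i < n ] ∑[ j < n ] f i j + ∑[ i < n ] ∑[ j < n ] g i j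
∑∑-distrib-+ {n} f g = trans (sum-cong-≗ {n} (λ i → ∑-distrib-+ (f i) (g i)))
                             (∑-distrib-+ (λ i → ∑[ j < n ] f i j) (λ i → ∑[ j < n ] g i j))

count : (Fin n → Bool) → ℕ
count {n} p = ∑[ i < n ] 𝟙 (p i)

listSum-allFin : (g : Fin n → ℕ) → List.sum (map g (allFin n)) ≡ sum g
listSum-allFin {n} g = trans (cong List.sum (map-tabulate {n = n} id g)) (sum-tabulate g)
  where
  sum-tabulate : ∀ {m} (f : Fin m → ℕ) → List.sum (tabulate f) ≡ sum f
  sum-tabulate {zero}  f = refl
  sum-tabulate {suc m} f = cong (f fzero +_) (sum-tabulate (f ∘ fsuc))

countV≡count : (p : Fin n → Bool) → countV p ≡ count p
countV≡count p = listSum-allFin (𝟙 ∘ p)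

count-at : (v : Fin n) → count (_≡ᵇ v) ≡ 1
count-at v = ∑-at v (λ _ → 1)

unique⇒count≤1 : (p : Fin n → Bool) → (∀ {a b} → p a ≡ true → p b ≡ true → a ≡ b) → count p ≤ 1
unique⇒count≤1 {n} p unique with any? (λ a → p a Bool.≟ true)
... | yes (a , pa) = ≤-trans (∑-mono-≤ below-a) (≤-reflexive (count-at a))
  where
  below-a : ∀ i → 𝟙 (p i) ≤ 𝟙 (i ≡ᵇ a)
  below-a i with p i in pi
  ... | false = z≤n
  ... | true rewrite unique pi pa | ≡ᵇ-refl a = ≤-refl
... | no none = ≤-trans (∑-mono-≤ {g = λ _ → 0} nowhere) (≤-trans (≤-reflexive (sum-replicate-zero n)) z≤n)
  where
  nowhere : ∀ i → 𝟙 (p i) ≤ 0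
  nowhere i with p i in pi
  ... | false = z≤n
  ... | true  = ⊥-elim (none (i , pi))

count-complement : (p : Fin n → Bool) → count p + count (not ∘ p) ≡ n
count-complement {n} p = begin
  count p + count (not ∘ p)          ≡⟨ sym (∑-distrib-+ (𝟙 ∘ p) (𝟙 ∘ not ∘ p)) ⟩
  ∑[ i < n ] (𝟙 (p i) + 𝟙 (not (p i))) ≡⟨ sum-cong-≗ (λ i → one (p i)) ⟩
  ∑[ i < n ] 1                       ≡⟨ trans (∑-const n 1) (*-identityʳ n) ⟩
  n                                  ∎
  where
  open ≡-Reasoning
  one : ∀ b → 𝟙 b + 𝟙 (not b) ≡ 1
  one true  = refl
  one false = refl

count-insert : (p : Fin n → Bool) (v : Fin n) → count (λ i → p i ∨ i ≡ᵇ v) ≤ count p + 1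
count-insert {n} p v = begin
  count (λ i → p i ∨ i ≡ᵇ v)          ≤⟨ ∑-mono-≤ (λ i → 𝟙-∨ (p i) (i ≡ᵇ v)) ⟩
  ∑[ i < n ] (𝟙 (p i) + 𝟙 (i ≡ᵇ v))   ≡⟨ ∑-distrib-+ (𝟙 ∘ p) (λ i → 𝟙 (i ≡ᵇ v)) ⟩
  count p + count (_≡ᵇ v)             ≡⟨ cong (count p +_) (count-at v) ⟩
  count p + 1                         ∎
  where
  open ≤-Reasoning
  𝟙-∨ : ∀ x y → 𝟙 (x ∨ y) ≤ 𝟙 x + 𝟙 y
  𝟙-∨ true  _     = s≤s z≤n
  𝟙-∨ false _     = ≤-refl

count-remove : (p : Fin n → Bool) {v : Fin n} → p v ≡ true → count (λ i → p i ∧ not (i ≡ᵇ v)) + 1 ≡ count p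
count-remove {n} p {v} pv = begin
  count (λ i → p i ∧ not (i ≡ᵇ v)) + 1
    ≡⟨ cong (count (λ i → p i ∧ not (i ≡ᵇ v)) +_) (sym (trans (∑-at v (𝟙 ∘ p)) (cong 𝟙 pv))) ⟩
  count (λ i → p i ∧ not (i ≡ᵇ v)) + ∑[ i < n ] (if i ≡ᵇ v then 𝟙 (p i) else 0)
    ≡⟨ sym (∑-distrib-+ (λ i → 𝟙 (p i ∧ not (i ≡ᵇ v))) (λ i → if i ≡ᵇ v then 𝟙 (p i) else 0)) ⟩
  ∑[ i < n ] (𝟙 (p i ∧ not (i ≡ᵇ v)) + (if i ≡ᵇ v then 𝟙 (p i) else 0))
    ≡⟨ sum-cong-≗ (λ i → split (p i) (i ≡ᵇ v)) ⟩
  count p ∎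
  where
  open ≡-Reasoning
  split : ∀ x e → 𝟙 (x ∧ not e) + (if e then 𝟙 x else 0) ≡ 𝟙 x
  split true  true  = refl
  split true  false = refl
  split false true  = refl
  split false false = refl

-- Edge counting and elementary graph operations

countOrdered : (Fin n → Fin n → Bool) → ℕ
countOrdered {n} f = ∑[ i < n ] count (f i)

countOrdered-transpose : (f : Fin n → Fin n → Bool) → countOrdered f ≡ countOrdered (λ i j → f j i)
countOrdered-transpose f = ∑-comm (λ i j → 𝟙 (f i j))

countOrdered≡2*countPairs : (f : Fin n → Fin n → Bool) → (∀ i j → f i j ≡ f j i) → (∀ i → f i i ≡ false) →
                            countOrdered f ≡ 2 * countPairs f
countOrdered≡2*countPairs {n} f f-sym f-irrefl = begin
  countOrdered f                                            ≡⟨ ∑∑-cong split ⟩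
  ∑[ i < n ] ∑[ j < n ] (A i j + A j i)                     ≡⟨ ∑∑-distrib-+ A (λ i j → A j i) ⟩
  ∑[ i < n ] ∑[ j < n ] A i j + ∑[ i < n ] ∑[ j < n ] A j i ≡⟨ cong (P +_) (∑-comm (λ i j → A j i)) ⟩
  P + P                                                     ≡⟨ cong (P +_) (sym (+-identityʳ P)) ⟩
  P + (P + 0)                                               ≡⟨ cong (2 *_) (sym countPairs≡P) ⟩
  2 * countPairs f                                          ∎
  where
  open ≡-Reasoning
  A : Fin n → Fin n → ℕ
  A i j = 𝟙 ((toℕ i <ᵇ toℕ j) ∧ f i j)
  P = ∑[ i < n ] ∑[ j < n ] A i j
  countPairs≡P : countPairs f ≡ P
  countPairs≡P = trans (listSum-allFin (λ i → countV (λ j → (toℕ i <ᵇ toℕ j) ∧ f i j)))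
                       (sum-cong-≗ (λ i → countV≡count (λ j → (toℕ i <ᵇ toℕ j) ∧ f i j)))
  split : ∀ i j → 𝟙 (f i j) ≡ A i j + A j i
  split i j with <-cmp (toℕ i) (toℕ j)
  ... | tri< i<j _ j≮i rewrite dec-true (toℕ i <? toℕ j) i<j | dec-false (toℕ j <? toℕ i) j≮i =
    sym (+-identityʳ _)
  ... | tri> i≮j _ j<i rewrite dec-false (toℕ i <? toℕ j) i≮j | dec-true (toℕ j <? toℕ i) j<i | f-sym i j = refl
  ... | tri≈ i≮j i≡j _ rewrite toℕ-injective i≡j | f-irrefl j | ∧-zeroʳ (toℕ j <ᵇ toℕ j) = refl

handshake : (H : Graph n) → countOrdered (adj H) ≡ 2 * numEdges H
handshake H = countOrdered≡2*countPairs (adj H) (Graph.sym H) (irrefl H)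

isPair : Fin n → Fin n → Fin n → Fin n → Bool
isPair a b i j = (i ≡ᵇ a ∧ j ≡ᵇ b) ∨ (i ≡ᵇ b ∧ j ≡ᵇ a)

isPair-sym : (a b i j : Fin n) → isPair a b i j ≡ isPair a b j i
isPair-sym a b i j = trans (cong₂ _∨_ (∧-comm (i ≡ᵇ a) (j ≡ᵇ b)) (∧-comm (i ≡ᵇ b) (j ≡ᵇ a)))
                           (∨-comm (j ≡ᵇ b ∧ i ≡ᵇ a) (j ≡ᵇ a ∧ i ≡ᵇ b))

isPair-cases : (a b i j : Fin n) → (i ≡ a × j ≡ b) ⊎ (i ≡ b × j ≡ a) ⊎ isPair a b i j ≡ false
isPair-cases a b i j with i ≟ a | j ≟ b
... | yes i≡a | yes j≡b = inj₁ (i≡a , j≡b)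
... | yes _   | no _    with i ≟ b | j ≟ a
...   | yes i≡b | yes j≡a = inj₂ (inj₁ (i≡b , j≡a))
...   | yes _   | no _    = inj₂ (inj₂ refl)
...   | no _    | _       = inj₂ (inj₂ refl)
isPair-cases a b i j | no _ | _ with i ≟ b | j ≟ a
...   | yes i≡b | yes j≡a = inj₂ (inj₁ (i≡b , j≡a))
...   | yes _   | no _    = inj₂ (inj₂ refl)
...   | no _    | _       = inj₂ (inj₂ refl)

isPair-irrefl : {a b : Fin n} → a ≢ b → ∀ i → isPair a b i i ≡ false
isPair-irrefl {a = a} {b} a≢b i with isPair-cases a b i i
... | inj₁ (refl , refl)        = ⊥-elim (a≢b refl)
... | inj₂ (inj₁ (refl , refl)) = ⊥-elim (a≢b refl)
... | inj₂ (inj₂ ¬pair)         = ¬pair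

isPair-ab : (a b : Fin n) → isPair a b a b ≡ true
isPair-ab a b rewrite ≡ᵇ-refl a | ≡ᵇ-refl b = refl

isPair-ba : (a b : Fin n) → isPair a b b a ≡ true
isPair-ba a b rewrite ≡ᵇ-refl a | ≡ᵇ-refl b = ∨-zeroʳ (b ≡ᵇ a ∧ a ≡ᵇ b)

countOrdered-point : (a b : Fin n) → countOrdered (λ i j → i ≡ᵇ a ∧ j ≡ᵇ b) ≡ 1
countOrdered-point {n} a b = trans (sum-cong-≗ row) (trans (∑-at a (λ _ → count (_≡ᵇ b))) (count-at b))
  where
  row : ∀ i → count (λ j → i ≡ᵇ a ∧ j ≡ᵇ b) ≡ (if i ≡ᵇ a then count (_≡ᵇ b) else 0)
  row i with i ≡ᵇ a
  ... | true  = refl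
  ... | false = sum-replicate-zero n

countOrdered-isPair : {a b : Fin n} → a ≢ b → countOrdered (isPair a b) ≡ 2
countOrdered-isPair {n} {a} {b} a≢b = begin
  countOrdered (isPair a b)
    ≡⟨ ∑∑-cong disjoint ⟩
  ∑[ i < n ] ∑[ j < n ] (𝟙 (i ≡ᵇ a ∧ j ≡ᵇ b) + 𝟙 (i ≡ᵇ b ∧ j ≡ᵇ a))
    ≡⟨ ∑∑-distrib-+ (λ i j → 𝟙 (i ≡ᵇ a ∧ j ≡ᵇ b)) (λ i j → 𝟙 (i ≡ᵇ b ∧ j ≡ᵇ a)) ⟩
  countOrdered (λ i j → i ≡ᵇ a ∧ j ≡ᵇ b) + countOrdered (λ i j → i ≡ᵇ b ∧ j ≡ᵇ a)
    ≡⟨ cong₂ _+_ (countOrdered-point a b) (countOrdered-point b a) ⟩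
  2 ∎
  where
  open ≡-Reasoning
  disjoint : ∀ i j → 𝟙 (isPair a b i j) ≡ 𝟙 (i ≡ᵇ a ∧ j ≡ᵇ b) + 𝟙 (i ≡ᵇ b ∧ j ≡ᵇ a)
  disjoint i j with i ≟ a | i ≟ b
  ... | yes refl | yes refl = ⊥-elim (a≢b refl)
  ... | yes _    | no _     rewrite ∨-identityʳ (j ≡ᵇ b) = sym (+-identityʳ _)
  ... | no _     | _        = refl

isPair-true : {a b i j : Fin n} → isPair a b i j ≡ true → (i ≡ a × j ≡ b) ⊎ (i ≡ b × j ≡ a)
isPair-true {a = a} {b} {i} {j} pair with isPair-cases a b i j
... | inj₁ ab          = inj₁ ab
... | inj₂ (inj₁ ba)   = inj₂ ba
... | inj₂ (inj₂ ¬pair) = ⊥-elim (false≢true (trans (sym ¬pair) pair))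

adj-isPair : (H : Graph n) {a b i j : Fin n} → isPair a b i j ≡ true → adj H i j ≡ adj H a b
adj-isPair H {a} {b} {i} {j} pair with isPair-true {a = a} {b} {i} {j} pair
... | inj₁ (refl , refl) = refl
... | inj₂ (refl , refl) = Graph.sym H _ _

adj⇒≢ : (H : Graph n) {i j : Fin n} → adj H i j ≡ true → i ≢ j
adj⇒≢ H {i} ij∈H refl = false≢true (trans (sym (irrefl H i)) ij∈H)

numEdges-insert : (H H′ : Graph n) {a b : Fin n} → a ≢ b → adj H a b ≡ false →
                  (∀ i j → adj H′ i j ≡ adj H i j ∨ isPair a b i j) → numEdges H′ ≡ suc (numEdges H)
numEdges-insert {n} H H′ {a} {b} a≢b ab∉H H′≡H+ab = *-cancelˡ-≡ _ _ 2 (begin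
  2 * numEdges H′
    ≡⟨ sym (handshake H′) ⟩
  countOrdered (adj H′)
    ≡⟨ ∑∑-cong split ⟩
  ∑[ i < n ] ∑[ j < n ] (𝟙 (adj H i j) + 𝟙 (isPair a b i j))
    ≡⟨ ∑∑-distrib-+ (λ i j → 𝟙 (adj H i j)) (λ i j → 𝟙 (isPair a b i j)) ⟩
  countOrdered (adj H) + countOrdered (isPair a b)
    ≡⟨ cong₂ _+_ (handshake H) (countOrdered-isPair a≢b) ⟩
  2 * numEdges H + 2
    ≡⟨ trans (+-comm _ 2) (sym (*-suc 2 (numEdges H))) ⟩
  2 * suc (numEdges H) ∎)
  where
  open ≡-Reasoning
  split : ∀ i j → 𝟙 (adj H′ i j) ≡ 𝟙 (adj H i j) + 𝟙 (isPair a b i j)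
  split i j rewrite H′≡H+ab i j with isPair a b i j in pair
  ... | true  rewrite adj-isPair H {a} {b} {i} {j} pair | ab∉H = refl
  ... | false rewrite ∨-identityʳ (adj H i j) = sym (+-identityʳ _)

emptyGraph : Graph n
emptyGraph = record { adj = λ _ _ → false ; sym = λ _ _ → refl ; irrefl = λ _ → refl }

addEdge : (H : Graph n) (a b : Fin n) → a ≢ b → Graph n
addEdge H a b a≢b = record
  { adj    = λ i j → adj H i j ∨ isPair a b i j
  ; sym    = λ i j → cong₂ _∨_ (Graph.sym H i j) (isPair-sym a b i j)
  ; irrefl = λ i → cong₂ _∨_ (irrefl H i) (isPair-irrefl a≢b i)
  }

removeEdge : Graph n → Fin n → Fin n → Graph n
removeEdge H a b = record
  { adj    = λ i j → adj H i j ∧ not (isPair a b i j)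
  ; sym    = λ i j → cong₂ (λ x y → x ∧ not y) (Graph.sym H i j) (isPair-sym a b i j)
  ; irrefl = λ i → cong (_∧ not (isPair a b i i)) (irrefl H i)
  }

removeVertex : Graph n → Fin n → Graph n
removeVertex H v = record
  { adj    = λ i j → adj H i j ∧ not (i ≡ᵇ v ∨ j ≡ᵇ v)
  ; sym    = λ i j → cong₂ (λ x y → x ∧ not y) (Graph.sym H i j) (∨-comm (i ≡ᵇ v) (j ≡ᵇ v))
  ; irrefl = λ i → cong (_∧ not (i ≡ᵇ v ∨ i ≡ᵇ v)) (irrefl H i)
  }

removeEdge-excludes : (M : Graph n) {a b i j : Fin n} → isPair a b i j ≡ true → adj (removeEdge M a b) i j ≡ false
removeEdge-excludes M {i = i} {j} pair rewrite pair = ∧-zeroʳ (adj M i j)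

numEdges-addEdge : (H : Graph n) {a b : Fin n} (a≢b : a ≢ b) → adj H a b ≡ false →
                   numEdges (addEdge H a b a≢b) ≡ suc (numEdges H)
numEdges-addEdge H {a} {b} a≢b ab∉H = numEdges-insert H (addEdge H a b a≢b) a≢b ab∉H (λ _ _ → refl)

numEdges-removeEdge : (H : Graph n) {a b : Fin n} → adj H a b ≡ true → numEdges H ≡ suc (numEdges (removeEdge H a b))
numEdges-removeEdge H {a} {b} ab∈H = numEdges-insert (removeEdge H a b) H (adj⇒≢ H ab∈H) ab∉H-ab restore
  where
  ab∉H-ab : adj (removeEdge H a b) a b ≡ false
  ab∉H-ab = removeEdge-excludes H {a} {b} {a} {b} (isPair-ab a b)
  restore : ∀ i j → adj H i j ≡ (adj H i j ∧ not (isPair a b i j)) ∨ isPair a b i j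
  restore i j with isPair a b i j in pair
  ... | true  rewrite adj-isPair H {a} {b} {i} {j} pair | ab∈H = refl
  ... | false rewrite ∧-identityʳ (adj H i j) | ∨-identityʳ (adj H i j) = refl

UniqueNeighbours : Graph n → Set
UniqueNeighbours M = ∀ i j k → adj M i j ≡ true → adj M i k ≡ true → j ≡ k

Covers : Graph n → (Fin n → Bool) → Set
Covers H C = ∀ i j → adj H i j ≡ true → C i ≡ true ⊎ C j ≡ true

uniqueNeighbours⇒count≤1 : {M : Graph n} → UniqueNeighbours M → ∀ i → count (adj M i) ≤ 1
uniqueNeighbours⇒count≤1 unique i = unique⇒count≤1 _ (unique i _ _)

numEdges≤cover : {N : Graph n} {C : Fin n → Bool} → UniqueNeighbours N → Covers N C → numEdges N ≤ count C
numEdges≤cover {n} {N} {C} unique covers = *-cancelˡ-≤ 2 (begin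
  2 * numEdges N                                   ≡⟨ sym (handshake N) ⟩
  countOrdered (adj N)                             ≤⟨ ∑-mono-≤ (λ i → ∑-mono-≤ (covered i)) ⟩
  ∑[ i < n ] ∑[ j < n ] (𝟙 (C i ∧ adj N i j) + 𝟙 (C j ∧ adj N i j))
    ≡⟨ ∑∑-distrib-+ (λ i j → 𝟙 (C i ∧ adj N i j)) (λ i j → 𝟙 (C j ∧ adj N i j)) ⟩
  atCover + countOrdered (λ i j → C j ∧ adj N i j) ≡⟨ cong (atCover +_) transposed ⟩
  atCover + atCover                                ≤⟨ +-mono-≤ atCover≤C atCover≤C ⟩
  count C + count C                                ≡⟨ cong (count C +_) (sym (+-identityʳ (count C))) ⟩
  2 * count C                                      ∎)
  where
  open ≤-Reasoning
  atCover = countOrdered (λ i j → C i ∧ adj N i j)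
  covered : ∀ i j → 𝟙 (adj N i j) ≤ 𝟙 (C i ∧ adj N i j) + 𝟙 (C j ∧ adj N i j)
  covered i j with adj N i j in ij∈N
  ... | false = z≤n
  ... | true with covers i j ij∈N
  ...   | inj₁ Ci rewrite Ci = s≤s z≤n
  ...   | inj₂ Cj rewrite Cj = m≤n+m 1 _
  transposed : countOrdered (λ i j → C j ∧ adj N i j) ≡ atCover
  transposed = trans (countOrdered-transpose (λ i j → C j ∧ adj N i j))
                     (∑∑-cong (λ i j → cong (λ b → 𝟙 (C i ∧ b)) (Graph.sym N j i)))
  row : ∀ i → count (λ j → C i ∧ adj N i j) ≤ 𝟙 (C i)
  row i with C i
  ... | true  = uniqueNeighbours⇒count≤1 {M = N} unique i
  ... | false = ≤-reflexive (sum-replicate-zero n)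
  atCover≤C : atCover ≤ count C
  atCover≤C = ∑-mono-≤ row

Isolated : Graph n → Fin n → Set
Isolated M x = ∀ j → adj M x j ≡ false

noEdge⇒isolated : (G : Graph n) {x : Fin n} → (∀ j → adj G x j ≡ true → ⊥) → Isolated G x
noEdge⇒isolated G {x} noEdge j with adj G x j in xj∈G
... | false = refl
... | true  = ⊥-elim (noEdge j xj∈G)

⊆G-trans : {M H G : Graph n} → M ⊆G H → H ⊆G G → M ⊆G G
⊆G-trans M⊆H H⊆G i j ij∈M = H⊆G i j (M⊆H i j ij∈M)

⊆G-uniqueNeighbours : {M′ M : Graph n} → M′ ⊆G M → UniqueNeighbours M → UniqueNeighbours M′
⊆G-uniqueNeighbours M′⊆M unique i j k ij∈M′ ik∈M′ = unique i j k (M′⊆M i j ij∈M′) (M′⊆M i k ik∈M′)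

⊆G-isolated : {M′ M : Graph n} → M′ ⊆G M → ∀ {x} → Isolated M x → Isolated M′ x
⊆G-isolated {M′ = M′} M′⊆M {x} isolated j with adj M′ x j in xj∈M′
... | false = refl
... | true  = ⊥-elim (false≢true (trans (sym (isolated j)) (M′⊆M x j xj∈M′)))

⊆G-bipartite : {H′ H : Graph n} → H′ ⊆G H → Bipartite H → Bipartite H′
⊆G-bipartite H′⊆H (colour , proper) = colour , λ i j ij∈H′ → proper i j (H′⊆H i j ij∈H′)

removeVertex-⊆G : (H : Graph n) (v : Fin n) → removeVertex H v ⊆G H
removeVertex-⊆G H v i j ij∈H-v with adj H i j
... | true = refl

removeVertex-avoids : (H : Graph n) (v : Fin n) {i j : Fin n} → adj (removeVertex H v) i j ≡ true → i ≢ v × j ≢ v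
removeVertex-avoids H v {i} {j} ij∈H-v with adj H i j | i ≟ v | j ≟ v
... | true | no i≢v | no j≢v = i≢v , j≢v

removeVertex-intro : (H : Graph n) (v : Fin n) {i j : Fin n} → adj H i j ≡ true → i ≢ v → j ≢ v →
                     adj (removeVertex H v) i j ≡ true
removeVertex-intro H v ij∈H i≢v j≢v rewrite ij∈H | ≡ᵇ-≢ i≢v | ≡ᵇ-≢ j≢v = refl

removeVertex-isolated : (H : Graph n) (v : Fin n) → Isolated (removeVertex H v) v
removeVertex-isolated H v j rewrite ≡ᵇ-refl v = ∧-zeroʳ (adj H v j)

removeEdge-⊆G : (H : Graph n) (a b : Fin n) → removeEdge H a b ⊆G H
removeEdge-⊆G H a b i j ij∈H-ab with adj H i j
... | true = refl

removeEdge-intro : (H : Graph n) {a b i j : Fin n} → adj H i j ≡ true → isPair a b i j ≡ false →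
                   adj (removeEdge H a b) i j ≡ true
removeEdge-intro H ij∈H ¬pair rewrite ij∈H | ¬pair = refl

removeEdge-isolated : (M : Graph n) {a b : Fin n} → UniqueNeighbours M → adj M a b ≡ true →
                      Isolated (removeEdge M a b) a × Isolated (removeEdge M a b) b
removeEdge-isolated M {a} {b} unique ab∈M =
  noEdge⇒isolated (removeEdge M a b) (λ j aj∈ → only-other a b (isPair-ab a b) ab∈M j aj∈) ,
  noEdge⇒isolated (removeEdge M a b) (λ j bj∈ → only-other b a (isPair-ba a b) (trans (Graph.sym M b a) ab∈M) j bj∈)
  where
  only-other : ∀ x y → isPair a b x y ≡ true → adj M x y ≡ true → ∀ j → adj (removeEdge M a b) x j ≡ true → ⊥
  only-other x y pair xy∈M j xj∈ with unique x j y (removeEdge-⊆G M a b x j xj∈) xy∈M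
  ... | refl = false≢true (trans (sym (removeEdge-excludes M {a} {b} {x} {j} pair)) xj∈)

addEdge-cases : (M : Graph n) {a b : Fin n} (a≢b : a ≢ b) {i j : Fin n} → adj (addEdge M a b a≢b) i j ≡ true →
                adj M i j ≡ true ⊎ isPair a b i j ≡ true
addEdge-cases M {a} {b} _ {i} {j} ij∈M+ab with adj M i j
... | true  = inj₁ refl
... | false = inj₂ ij∈M+ab

addEdge-⊆G : {M H : Graph n} {a b : Fin n} (a≢b : a ≢ b) → M ⊆G H → adj H a b ≡ true → addEdge M a b a≢b ⊆G H
addEdge-⊆G {M = M} {H} {a} {b} a≢b M⊆H ab∈H i j ij∈M+ab with addEdge-cases M a≢b ij∈M+ab
... | inj₁ ij∈M = M⊆H i j ij∈M
... | inj₂ pair = trans (adj-isPair H {a} {b} {i} {j} pair) ab∈H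

isPair-isolated : {M : Graph n} {a b : Fin n} → Isolated M a → Isolated M b →
                  ∀ {i j} → isPair a b i j ≡ true → Isolated M i
isPair-isolated {a = a} {b} a-iso b-iso {i} {j} pair with isPair-true {a = a} {b} {i} {j} pair
... | inj₁ (refl , _) = a-iso
... | inj₂ (refl , _) = b-iso

addEdge-uniqueNeighbours : {M : Graph n} {a b : Fin n} (a≢b : a ≢ b) → UniqueNeighbours M → Isolated M a → Isolated M b →
                           UniqueNeighbours (addEdge M a b a≢b)
addEdge-uniqueNeighbours {M = M} {a} {b} a≢b unique a-iso b-iso i j k ij∈ ik∈
  with addEdge-cases M a≢b ij∈ | addEdge-cases M a≢b ik∈
... | inj₁ ij∈M | inj₁ ik∈M = unique i j k ij∈M ik∈M
... | inj₁ ij∈M | inj₂ pair =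
  ⊥-elim (false≢true (trans (sym (isPair-isolated {M = M} {a} {b} a-iso b-iso {i} {k} pair j)) ij∈M))
... | inj₂ pair | inj₁ ik∈M =
  ⊥-elim (false≢true (trans (sym (isPair-isolated {M = M} {a} {b} a-iso b-iso {i} {j} pair k)) ik∈M))
... | inj₂ pair₁ | inj₂ pair₂ with isPair-true {a = a} {b} {i} {j} pair₁ | isPair-true {a = a} {b} {i} {k} pair₂
...   | inj₁ (_ , refl) | inj₁ (_ , refl) = refl
...   | inj₂ (_ , refl) | inj₂ (_ , refl) = refl
...   | inj₁ (refl , _) | inj₂ (i≡b , _) = ⊥-elim (a≢b i≡b)
...   | inj₂ (refl , _) | inj₁ (i≡a , _) = ⊥-elim (a≢b (sym i≡a))

addEdge-isolated : {M : Graph n} {a b : Fin n} (a≢b : a ≢ b) {c : Fin n} → Isolated M c → c ≢ a → c ≢ b →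
                   Isolated (addEdge M a b a≢b) c
addEdge-isolated {M = M} {a} {b} a≢b {c} c-iso c≢a c≢b j rewrite c-iso j | ≡ᵇ-≢ c≢a | ≡ᵇ-≢ c≢b = refl

-- Kőnig's theorem

record MatchingOfSize (H : Graph n) (k : ℕ) : Set where
  field
    edges   : Graph n
    edges⊆H : edges ⊆G H
    unique  : UniqueNeighbours edges
    size    : numEdges edges ≡ k

addDisjointEdge : (H M : Graph n) {a b : Fin n} → M ⊆G H → UniqueNeighbours M → adj H a b ≡ true →
                  Isolated M a → Isolated M b → MatchingOfSize H (suc (numEdges M))
addDisjointEdge H M {a} {b} M⊆H unique ab∈H a-isolated b-isolated = record
  { edges   = addEdge M a b a≢b
  ; edges⊆H = addEdge-⊆G {M = M} {H} a≢b M⊆H ab∈H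
  ; unique  = addEdge-uniqueNeighbours {M = M} a≢b unique a-isolated b-isolated
  ; size    = numEdges-addEdge M a≢b (a-isolated b)
  }
  where a≢b = adj⇒≢ H ab∈H

addTwoDisjointEdges : (H M : Graph n) {a b c d : Fin n} → M ⊆G H → UniqueNeighbours M →
                      adj H a b ≡ true → adj H c d ≡ true → c ≢ a → c ≢ b → d ≢ a → d ≢ b →
                      Isolated M a → Isolated M b → Isolated M c → Isolated M d →
                      MatchingOfSize H (suc (suc (numEdges M)))
addTwoDisjointEdges H M {a} {b} {c} {d} M⊆H unique ab∈H cd∈H c≢a c≢b d≢a d≢b a-iso b-iso c-iso d-iso =
  record { edges = edges ; edges⊆H = edges⊆H ; unique = unique′ ; size = trans size (cong suc M+ab.size) }
  where
  a≢b = adj⇒≢ H ab∈H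
  module M+ab = MatchingOfSize (addDisjointEdge H M M⊆H unique ab∈H a-iso b-iso)
  open MatchingOfSize (addDisjointEdge H M+ab.edges M+ab.edges⊆H M+ab.unique cd∈H
                         (addEdge-isolated {M = M} a≢b c-iso c≢a c≢b) (addEdge-isolated {M = M} a≢b d-iso d≢a d≢b))
    renaming (unique to unique′)

record KőnigWitness (H : Graph n) : Set where
  field
    matching       : Graph n
    cover          : Fin n → Bool
    matching⊆H     : matching ⊆G H
    unique         : UniqueNeighbours matching
    covers         : Covers H cover
    cover≤matching : count cover ≤ numEdges matching

edgelessWitness : (H : Graph n) → (∀ u → Isolated H u) → KőnigWitness H
edgelessWitness {n} H isolated = record
  { matching       = emptyGraph
  ; cover          = λ _ → false
  ; matching⊆H     = λ _ _ ()
  ; unique         = λ _ _ _ ()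
  ; covers         = λ i j ij∈H → ⊥-elim (false≢true (trans (sym (isolated i j)) ij∈H))
  ; cover≤matching = ≤-trans (≤-reflexive (sum-replicate-zero n)) z≤n
  }

covers-insert : (H : Graph n) (v : Fin n) {C : Fin n → Bool} → Covers (removeVertex H v) C →
                Covers H (λ i → C i ∨ i ≡ᵇ v)
covers-insert H v {C} covers i j ij∈H with i ≟ v | j ≟ v
... | yes _   | _       = inj₁ (∨-zeroʳ (C i))
... | no _    | yes _   = inj₂ (∨-zeroʳ (C j))
... | no i≢v  | no j≢v  with covers i j (removeVertex-intro H v ij∈H i≢v j≢v)
...   | inj₁ Ci = inj₁ (cong (_∨ false) Ci)
...   | inj₂ Cj = inj₂ (cong (_∨ false) Cj)

covers-removeEdge : (H : Graph n) {a b : Fin n} {C : Fin n → Bool} → Covers (removeEdge H a b) C →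
                    C a ≡ true ⊎ C b ≡ true → Covers H C
covers-removeEdge H {a} {b} covers ab-covered i j ij∈H with isPair-cases a b i j
... | inj₁ (refl , refl)        = ab-covered
... | inj₂ (inj₁ (refl , refl)) = Sum.swap ab-covered
... | inj₂ (inj₂ ¬pair)         = covers i j (removeEdge-intro H ij∈H ¬pair)

leafWitness : (H : Graph n) {u v : Fin n} → adj H u v ≡ true → (∀ j → adj H u j ≡ true → j ≡ v) →
              KőnigWitness (removeVertex H v) → KőnigWitness H
leafWitness H {u} {v} uv∈H only-v W = record
  { matching       = edges
  ; cover          = λ i → C i ∨ i ≡ᵇ v
  ; matching⊆H     = edges⊆H
  ; unique         = unique′
  ; covers         = covers-insert H v covers
  ; cover≤matching = begin
      count (λ i → C i ∨ i ≡ᵇ v) ≤⟨ count-insert C v ⟩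
      count C + 1                ≤⟨ +-monoˡ-≤ 1 cover≤matching ⟩
      numEdges N + 1             ≡⟨ trans (+-comm (numEdges N) 1) (sym size) ⟩
      numEdges edges             ∎
  }
  where
  open KőnigWitness W renaming (matching to N; cover to C; matching⊆H to N⊆H-v)
  open ≤-Reasoning
  v-isolated : Isolated N v
  v-isolated = ⊆G-isolated {M′ = N} {removeVertex H v} N⊆H-v (removeVertex-isolated H v)
  u-isolated : Isolated N u
  u-isolated = noEdge⇒isolated N λ j uj∈N →
    proj₂ (removeVertex-avoids H v (N⊆H-v u j uj∈N)) (only-v j (removeVertex-⊆G H v u j (N⊆H-v u j uj∈N)))
  open MatchingOfSize (addDisjointEdge H N (⊆G-trans {M = N} {removeVertex H v} {H} N⊆H-v (removeVertex-⊆G H v))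
                                       unique uv∈H u-isolated v-isolated)
    renaming (unique to unique′)

restoredEdgeWitness : (H : Graph n) {a b : Fin n} (W : KőnigWitness (removeEdge H a b)) →
              KőnigWitness.cover W a ≡ true ⊎ KőnigWitness.cover W b ≡ true → KőnigWitness H
restoredEdgeWitness H {a} {b} W ab-covered = record
  { matching       = matching
  ; cover          = cover
  ; matching⊆H     = ⊆G-trans {M = matching} {removeEdge H a b} {H} matching⊆H (removeEdge-⊆G H a b)
  ; unique         = unique
  ; covers         = covers-removeEdge H covers ab-covered
  ; cover≤matching = cover≤matching
  }
  where open KőnigWitness W

-- If the cover C₂ of H − uw misses u and w, it contains v, and C₂ − v covers the matching N₁ of
-- H − v since N₁ avoids uw; so |N₁| < |C₂| ≤ |N₂| and C₁ ∪ {v} is small enough to go with N₂.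
rizziWitness : (H : Graph n) {u v w : Fin n} → adj H u v ≡ true → adj H u w ≡ true → v ≢ w →
               (W₁ : KőnigWitness (removeVertex H v)) → adj (KőnigWitness.matching W₁) u w ≡ false →
               KőnigWitness (removeEdge H u w) → KőnigWitness H
rizziWitness H {u} {v} {w} uv∈H uw∈H v≢w W₁ uw∉N₁ W₂
  with KőnigWitness.cover W₂ u in C₂u | KőnigWitness.cover W₂ w in C₂w
... | true  | _     = restoredEdgeWitness H W₂ (inj₁ C₂u)
... | false | true  = restoredEdgeWitness H W₂ (inj₂ C₂w)
... | false | false = record
  { matching       = N₂
  ; cover          = λ i → C₁ i ∨ i ≡ᵇ v
  ; matching⊆H     = ⊆G-trans {M = N₂} {removeEdge H u w} {H} N₂⊆H-uw (removeEdge-⊆G H u w)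
  ; unique         = unique₂
  ; covers         = covers-insert H v covers₁
  ; cover≤matching = begin
      count (λ i → C₁ i ∨ i ≡ᵇ v) ≤⟨ count-insert C₁ v ⟩
      count C₁ + 1                ≤⟨ +-monoˡ-≤ 1 (≤-trans cover≤matching₁ N₁≤C₂-v) ⟩
      count C₂-v + 1              ≡⟨ count-remove C₂ C₂v ⟩
      count C₂                    ≤⟨ cover≤matching₂ ⟩
      numEdges N₂                 ∎
  }
  where
  open KőnigWitness W₁ renaming (matching to N₁; cover to C₁; matching⊆H to N₁⊆H-v; unique to unique₁;
                                 covers to covers₁; cover≤matching to cover≤matching₁)
  open KőnigWitness W₂ renaming (matching to N₂; cover to C₂; matching⊆H to N₂⊆H-uw; unique to unique₂;
                                 covers to covers₂; cover≤matching to cover≤matching₂)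
  open ≤-Reasoning
  C₂v : C₂ v ≡ true
  C₂v with covers₂ u v (removeEdge-intro H uv∈H uv≠uw)
    where
    uv≠uw : isPair u w u v ≡ false
    uv≠uw rewrite ≡ᵇ-refl u | ≡ᵇ-≢ v≢w | ≡ᵇ-≢ (adj⇒≢ H uw∈H) = refl
  ... | inj₁ C₂u′ = ⊥-elim (false≢true (trans (sym C₂u) C₂u′))
  ... | inj₂ C₂v  = C₂v
  C₂-v : Fin _ → Bool
  C₂-v i = C₂ i ∧ not (i ≡ᵇ v)
  covers-N₁ : Covers N₁ C₂-v
  covers-N₁ i j ij∈N₁ with removeVertex-avoids H v (N₁⊆H-v i j ij∈N₁) | isPair u w i j in pair
  ... | _ | true = ⊥-elim (false≢true (trans (sym uw∉N₁) (trans (sym (adj-isPair N₁ {u} {w} {i} {j} pair)) ij∈N₁)))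
  ... | i≢v , j≢v | false
    with covers₂ i j (removeEdge-intro H (removeVertex-⊆G H v i j (N₁⊆H-v i j ij∈N₁)) pair)
  ...   | inj₁ C₂i rewrite C₂i | ≡ᵇ-≢ i≢v = inj₁ refl
  ...   | inj₂ C₂j rewrite C₂j | ≡ᵇ-≢ j≢v = inj₂ refl
  N₁≤C₂-v : numEdges N₁ ≤ count C₂-v
  N₁≤C₂-v = numEdges≤cover {N = N₁} unique₁ covers-N₁

throughW : Graph n → Fin n → Fin n → Fin n → Fin n → Fin n → Bool
throughW H u v w i j = i ≡ᵇ v ∧ (adj H w j ∧ not (j ≡ᵇ u ∨ j ≡ᵇ v))

throughW-irrefl : (H : Graph n) (u v w i : Fin n) → throughW H u v w i i ≡ false
throughW-irrefl H u v w i with i ≟ v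
... | yes refl rewrite ∨-zeroʳ (v ≡ᵇ u) = ∧-zeroʳ (adj H w v)
... | no _     = refl

-- The contraction of the path v–u–w to v: u and w are deleted and v inherits the other neighbours of w.
contract : Graph n → Fin n → Fin n → Fin n → Graph n
contract H u v w = record
  { adj    = λ i j → adj H-u-w i j ∨ (throughW H u v w i j ∨ throughW H u v w j i)
  ; sym    = λ i j → cong₂ _∨_ (Graph.sym H-u-w i j) (∨-comm (throughW H u v w i j) (throughW H u v w j i))
  ; irrefl = λ i → cong₂ _∨_ (irrefl H-u-w i) (cong₂ _∨_ (throughW-irrefl H u v w i) (throughW-irrefl H u v w i))
  }
  where
  H-u-w = removeVertex (removeVertex H u) w

JoinedViaW : Graph n → Fin n → Fin n → Fin n → Fin n → Set
JoinedViaW H u v w j = adj H w j ≡ true × j ≢ u × j ≢ v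

throughW-true : (H : Graph n) (u v w : Fin n) {i j : Fin n} → throughW H u v w i j ≡ true → i ≡ v × JoinedViaW H u v w j
throughW-true H u v w {i} {j} through with i ≟ v | adj H w j | j ≟ u | j ≟ v
... | yes i≡v | true | no j≢u | no j≢v = i≡v , refl , j≢u , j≢v

removeVertex²-edge : (H : Graph n) (u w : Fin n) {i j : Fin n} → adj (removeVertex (removeVertex H u) w) i j ≡ true →
                     adj H i j ≡ true × (i ≢ u × i ≢ w) × (j ≢ u × j ≢ w)
removeVertex²-edge H u w {i} {j} kept =
  removeVertex-⊆G H u i j ij∈H-u , (i≢u , i≢w) , (j≢u , j≢w)
  where
  ij∈H-u = removeVertex-⊆G (removeVertex H u) w i j kept
  i≢w = proj₁ (removeVertex-avoids (removeVertex H u) w kept)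
  j≢w = proj₂ (removeVertex-avoids (removeVertex H u) w kept)
  i≢u = proj₁ (removeVertex-avoids H u ij∈H-u)
  j≢u = proj₂ (removeVertex-avoids H u ij∈H-u)

contract-cases : (H : Graph n) (u v w : Fin n) {i j : Fin n} → adj (contract H u v w) i j ≡ true →
                 (adj H i j ≡ true × (i ≢ u × i ≢ w) × (j ≢ u × j ≢ w))
                 ⊎ (i ≡ v × JoinedViaW H u v w j) ⊎ (j ≡ v × JoinedViaW H u v w i)
contract-cases H u v w {i} {j} ij∈G*
  with adj (removeVertex (removeVertex H u) w) i j in kept
     | throughW H u v w i j in ij-through
     | throughW H u v w j i in ji-through
... | true  | _     | _     = inj₁ (removeVertex²-edge H u w kept)
... | false | true  | _     = inj₂ (inj₁ (throughW-true H u v w ij-through))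
... | false | false | true  = inj₂ (inj₂ (throughW-true H u v w ji-through))
... | false | false | false = ⊥-elim (false≢true ij∈G*)

contract-keeps : (H : Graph n) (u v w : Fin n) {i j : Fin n} → adj H i j ≡ true → i ≢ u → i ≢ w → j ≢ u → j ≢ w →
                 adj (contract H u v w) i j ≡ true
contract-keeps H u v w ij∈H i≢u i≢w j≢u j≢w
  rewrite removeVertex-intro (removeVertex H u) w (removeVertex-intro H u ij∈H i≢u j≢u) i≢w j≢w = refl

contract-joins : (H : Graph n) (u v w : Fin n) {j : Fin n} → JoinedViaW H u v w j → adj (contract H u v w) v j ≡ true
contract-joins H u v w {j} (wj∈H , j≢u , j≢v) =
  subst (λ x → adj (removeVertex (removeVertex H u) w) v j ∨ (x ∨ throughW H u v w j v) ≡ true)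
        (sym vj-through) (∨-zeroʳ (adj (removeVertex (removeVertex H u) w) v j))
  where
  vj-through : throughW H u v w v j ≡ true
  vj-through rewrite ≡ᵇ-refl v | wj∈H | ≡ᵇ-≢ j≢u | ≡ᵇ-≢ j≢v = refl

contract-isolated-u : (H : Graph n) {u v w : Fin n} → u ≢ v → Isolated (contract H u v w) u
contract-isolated-u H {u} {v} {w} u≢v = noEdge⇒isolated (contract H u v w) λ j uj∈G* →
  case contract-cases H u v w uj∈G* of λ where
    (inj₁ (_ , (u≢u , _) , _))        → u≢u refl
    (inj₂ (inj₁ (u≡v , _)))           → u≢v u≡v
    (inj₂ (inj₂ (_ , _ , u≢u , _)))   → u≢u refl

contract-isolated-w : (H : Graph n) {u v w : Fin n} → w ≢ v → Isolated (contract H u v w) w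
contract-isolated-w H {u} {v} {w} w≢v = noEdge⇒isolated (contract H u v w) λ j wj∈G* →
  case contract-cases H u v w wj∈G* of λ where
    (inj₁ (_ , (_ , w≢w) , _))      → w≢w refl
    (inj₂ (inj₁ (w≡v , _)))         → w≢v w≡v
    (inj₂ (inj₂ (_ , ww∈H , _)))    → adj⇒≢ H ww∈H refl

⊆contract⇒⊆G : (H M : Graph n) {u v w : Fin n} → M ⊆G contract H u v w → Isolated M v → M ⊆G H
⊆contract⇒⊆G H M {u} {v} {w} M⊆G* v-isolated i j ij∈M with contract-cases H u v w (M⊆G* i j ij∈M)
... | inj₁ (ij∈H , _)      = ij∈H
... | inj₂ (inj₁ (refl , _)) = ⊥-elim (false≢true (trans (sym (v-isolated j)) ij∈M))
... | inj₂ (inj₂ (refl , _)) = ⊥-elim (false≢true (trans (sym (v-isolated i)) (trans (Graph.sym M v i) ij∈M)))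

contract-properColouring : (H : Graph n) {u v w : Fin n} (c : Fin n → Bool) → (∀ i j → adj H i j ≡ true → c i ≢ c j) →
                           c v ≡ c w → ∀ i j → adj (contract H u v w) i j ≡ true → c i ≢ c j
contract-properColouring H {u} {v} {w} c proper cv≡cw i j ij∈G* with contract-cases H u v w ij∈G*
... | inj₁ (ij∈H , _)               = proper i j ij∈H
... | inj₂ (inj₁ (refl , wj∈H , _)) = λ cv≡cj → proper w j wj∈H (trans (sym cv≡cw) cv≡cj)
... | inj₂ (inj₂ (refl , wi∈H , _)) = λ ci≡cv → proper w i wi∈H (sym (trans ci≡cv cv≡cw))

-- If v is matched to y, the edge vy is replaced by vy and uw, or by wy and uv when it was inherited from w.
contract-liftMatching : (H : Graph n) {u v w : Fin n} → adj H u v ≡ true → adj H u w ≡ true → v ≢ w →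
                        (M : Graph n) → M ⊆G contract H u v w → UniqueNeighbours M →
                        MatchingOfSize H (suc (numEdges M))
contract-liftMatching H {u} {v} {w} uv∈H uw∈H v≢w M M⊆G* unique with any? (λ y → adj M v y Bool.≟ true)
... | no v-unmatched =
  addDisjointEdge H M (⊆contract⇒⊆G H M M⊆G* v-isolated) unique uv∈H u-isolated v-isolated
  where
  u-isolated = ⊆G-isolated {M′ = M} {contract H u v w} M⊆G* (contract-isolated-u H (adj⇒≢ H uv∈H))
  v-isolated = noEdge⇒isolated M (λ y vy∈M → v-unmatched (y , vy∈M))
... | yes (y , vy∈M) =
  subst (MatchingOfSize H) (cong suc (sym M-size)) (rematch (contract-cases H u v w (M⊆G* v y vy∈M)))
  where
  M′ = removeEdge M v y
  M′⊆M = removeEdge-⊆G M v y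
  M-size = numEdges-removeEdge M vy∈M
  v-isolated = proj₁ (removeEdge-isolated M unique vy∈M)
  y-isolated = proj₂ (removeEdge-isolated M unique vy∈M)
  inherited : ∀ {x} → Isolated (contract H u v w) x → Isolated M′ x
  inherited = ⊆G-isolated {M′ = M′} {M} M′⊆M ∘ ⊆G-isolated {M′ = M} {contract H u v w} M⊆G*
  u-isolated = inherited (contract-isolated-u H (adj⇒≢ H uv∈H))
  w-isolated = inherited (contract-isolated-w H (v≢w ∘ sym))
  M′⊆H = ⊆contract⇒⊆G H M′ (⊆G-trans {M = M′} {M} {contract H u v w} M′⊆M M⊆G*) v-isolated
  u≢v = adj⇒≢ H uv∈H
  u≢w = adj⇒≢ H uw∈H
  rematch : (adj H v y ≡ true × (v ≢ u × v ≢ w) × (y ≢ u × y ≢ w))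
            ⊎ (v ≡ v × JoinedViaW H u v w y) ⊎ (y ≡ v × JoinedViaW H u v w v) →
            MatchingOfSize H (suc (suc (numEdges M′)))
  rematch (inj₁ (vy∈H , _ , y≢u , y≢w)) =
    addTwoDisjointEdges H M′ M′⊆H (⊆G-uniqueNeighbours {M′ = M′} {M} M′⊆M unique) vy∈H uw∈H
      u≢v (y≢u ∘ sym) (v≢w ∘ sym) (y≢w ∘ sym) v-isolated y-isolated u-isolated w-isolated
  rematch (inj₂ (inj₁ (_ , wy∈H , y≢u , y≢v))) =
    addTwoDisjointEdges H M′ M′⊆H (⊆G-uniqueNeighbours {M′ = M′} {M} M′⊆M unique) wy∈H uv∈H
      u≢w (y≢u ∘ sym) v≢w (y≢v ∘ sym) w-isolated y-isolated u-isolated v-isolated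
  rematch (inj₂ (inj₂ (y≡v , _))) = ⊥-elim (adj⇒≢ M vy∈M (sym y≡v))

contract-cover-addW : (H : Graph n) {u v w : Fin n} → (∀ j → adj H u j ≡ true → j ≡ v ⊎ j ≡ w) →
                      {C : Fin n → Bool} → Covers (contract H u v w) C → C v ≡ true → Covers H (λ i → C i ∨ i ≡ᵇ w)
contract-cover-addW H {u} {v} {w} only-v-w {C} covers Cv i j ij∈H with i ≟ w | j ≟ w
... | yes _ | _     = inj₁ (∨-zeroʳ (C i))
... | no _  | yes _ = inj₂ (∨-zeroʳ (C j))
... | no i≢w | no j≢w with i ≟ u | j ≟ u
...   | yes refl | _ = case only-v-w j ij∈H of λ where
          (inj₁ refl) → inj₂ (cong (_∨ false) Cv)
          (inj₂ refl) → ⊥-elim (j≢w refl)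
...   | no _ | yes refl = case only-v-w i (trans (Graph.sym H u i) ij∈H) of λ where
          (inj₁ refl) → inj₁ (cong (_∨ false) Cv)
          (inj₂ refl) → ⊥-elim (i≢w refl)
...   | no i≢u | no j≢u = Sum.map (cong (_∨ false)) (cong (_∨ false))
                            (covers i j (contract-keeps H u v w ij∈H i≢u i≢w j≢u j≢w))

contract-coversJoined : (H : Graph n) {u v w : Fin n} → adj H w v ≡ false →
                        {C : Fin n → Bool} → Covers (contract H u v w) C → C v ≡ false →
                        ∀ {x} → x ≢ u → adj H w x ≡ true → C x ≡ true
contract-coversJoined H {u} {v} {w} wv∉H {C} covers ¬Cv {x} x≢u wx∈H
  with covers v x (contract-joins H u v w (wx∈H , x≢u , x≢v))
  where
  x≢v : x ≢ v
  x≢v refl = false≢true (trans (sym wv∉H) wx∈H)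
... | inj₁ Cv = ⊥-elim (false≢true (trans (sym ¬Cv) Cv))
... | inj₂ Cx = Cx

contract-cover-addU : (H : Graph n) {u v w : Fin n} → adj H w v ≡ false →
                      {C : Fin n → Bool} → Covers (contract H u v w) C → C v ≡ false → Covers H (λ i → C i ∨ i ≡ᵇ u)
contract-cover-addU H {u} {v} {w} wv∉H {C} covers ¬Cv i j ij∈H with i ≟ u | j ≟ u
... | yes _ | _     = inj₁ (∨-zeroʳ (C i))
... | no _  | yes _ = inj₂ (∨-zeroʳ (C j))
... | no i≢u | no j≢u with i ≟ w | j ≟ w
...   | yes refl | _        = inj₂ (cong (_∨ false) (contract-coversJoined H wv∉H covers ¬Cv j≢u ij∈H))
...   | no _     | yes refl =
  inj₁ (cong (_∨ false) (contract-coversJoined H wv∉H covers ¬Cv i≢u (trans (Graph.sym H w i) ij∈H)))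
...   | no i≢w   | no j≢w   = Sum.map (cong (_∨ false)) (cong (_∨ false))
                                (covers i j (contract-keeps H u v w ij∈H i≢u i≢w j≢u j≢w))

contractWitness : (H : Graph n) {u v w : Fin n} → adj H u v ≡ true → adj H u w ≡ true → v ≢ w → adj H w v ≡ false →
                  (∀ j → adj H u j ≡ true → j ≡ v ⊎ j ≡ w) → KőnigWitness (contract H u v w) → KőnigWitness H
contractWitness {n} H {u} {v} {w} uv∈H uw∈H v≢w wv∉H only-v-w W = record
  { matching       = edges
  ; cover          = proj₁ extendedCover
  ; matching⊆H     = edges⊆H
  ; unique         = unique′
  ; covers         = proj₁ (proj₂ extendedCover)
  ; cover≤matching = begin
      count (proj₁ extendedCover) ≤⟨ proj₂ (proj₂ extendedCover) ⟩
      count cover + 1             ≤⟨ +-monoˡ-≤ 1 cover≤matching ⟩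
      numEdges matching + 1       ≡⟨ trans (+-comm (numEdges matching) 1) (sym size) ⟩
      numEdges edges              ∎
  }
  where
  open KőnigWitness W
  open MatchingOfSize (contract-liftMatching H uv∈H uw∈H v≢w matching matching⊆H unique)
    renaming (unique to unique′)
  open ≤-Reasoning
  extendedCover : Σ (Fin n → Bool) λ C → Covers H C × count C ≤ count cover + 1
  extendedCover with cover v in Cv
  ... | true  = (λ i → cover i ∨ i ≡ᵇ w) , contract-cover-addW H only-v-w covers Cv , count-insert cover w
  ... | false = (λ i → cover i ∨ i ≡ᵇ u) , contract-cover-addU H wv∉H covers Cv , count-insert cover u

HasNeighbour : Graph n → Fin n → Set
HasNeighbour H i = ∃ λ j → adj H i j ≡ true

hasNeighbour? : (H : Graph n) (i : Fin n) → Dec (HasNeighbour H i)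
hasNeighbour? H i = any? (λ j → adj H i j Bool.≟ true)

nonIsolated : Graph n → ℕ
nonIsolated H = count (λ i → does (hasNeighbour? H i))

hasNeighbour-mono : (H′ H : Graph n) → (∀ i j → adj H′ i j ≡ true → HasNeighbour H i) → ∀ i →
                𝟙 (does (hasNeighbour? H′ i)) ≤ 𝟙 (does (hasNeighbour? H i))
hasNeighbour-mono H′ H inherit i with hasNeighbour? H′ i
... | no _       = z≤n
... | yes (j , e) rewrite dec-true (hasNeighbour? H i) (inherit i j e) = ≤-refl

nonIsolated-< : (H′ H : Graph n) → (∀ i j → adj H′ i j ≡ true → HasNeighbour H i) →
                ∀ {x} → HasNeighbour H x → Isolated H′ x → nonIsolated H′ < nonIsolated H
nonIsolated-< H′ H inherit {x} x-in-H x-isolated = ∑-mono-< (hasNeighbour-mono H′ H inherit) x strict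
  where
  strict : 𝟙 (does (hasNeighbour? H′ x)) < 𝟙 (does (hasNeighbour? H x))
  strict rewrite dec-true (hasNeighbour? H x) x-in-H
               | dec-false (hasNeighbour? H′ x) (λ (j , e) → false≢true (trans (sym (x-isolated j)) e)) = s≤s z≤n

measure : Graph n → ℕ × ℕ
measure H = nonIsolated H , numEdges H

_⊏_ : Graph n → Graph n → Set
_⊏_ = ×-Lex _≡_ _<_ _<_ on measure

⊏-wellFounded : WellFounded (_⊏_ {n})
⊏-wellFounded = On.wellFounded measure (×-wellFounded <-wellFounded <-wellFounded)

removeVertex-⊏ : (H : Graph n) {u v : Fin n} → adj H u v ≡ true → removeVertex H v ⊏ H
removeVertex-⊏ H {u} {v} uv∈H =
  inj₁ (nonIsolated-< (removeVertex H v) H (λ i j e → j , removeVertex-⊆G H v i j e)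
                      (u , trans (Graph.sym H v u) uv∈H) (removeVertex-isolated H v))

removeEdge-⊏ : (H : Graph n) {a b : Fin n} → adj H a b ≡ true → removeEdge H a b ⊏ H
removeEdge-⊏ H {a} {b} ab∈H
  with m≤n⇒m<n∨m≡n (∑-mono-≤ (hasNeighbour-mono (removeEdge H a b) H (λ i j e → j , removeEdge-⊆G H a b i j e)))
... | inj₁ fewer-vertices = inj₁ fewer-vertices
... | inj₂ same-vertices  = inj₂ (same-vertices , ≤-reflexive (sym (numEdges-removeEdge H ab∈H)))

contract-⊏ : (H : Graph n) {u v w : Fin n} → adj H u v ≡ true → contract H u v w ⊏ H
contract-⊏ H {u} {v} {w} uv∈H =
  inj₁ (nonIsolated-< (contract H u v w) H inherit (v , uv∈H) (contract-isolated-u H (adj⇒≢ H uv∈H)))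
  where
  inherit : ∀ i j → adj (contract H u v w) i j ≡ true → HasNeighbour H i
  inherit i j ij∈G* with contract-cases H u v w ij∈G*
  ... | inj₁ (ij∈H , _)               = j , ij∈H
  ... | inj₂ (inj₁ (refl , _))        = u , trans (Graph.sym H v u) uv∈H
  ... | inj₂ (inj₂ (_ , wi∈H , _))    = w , trans (Graph.sym H i w) wi∈H

threeNeighboursWitness : (H : Graph n) {u v w x : Fin n} → adj H u v ≡ true → adj H u w ≡ true → adj H u x ≡ true →
                         w ≢ v → x ≢ v → x ≢ w → KőnigWitness (removeVertex H v) →
                         (∀ t → adj H u t ≡ true → KőnigWitness (removeEdge H u t)) → KőnigWitness H
threeNeighboursWitness H {u} {v} {w} {x} uv∈H uw∈H ux∈H w≢v x≢v x≢w W₁ W₂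
  with adj (KőnigWitness.matching W₁) u w in uw∈N₁ | adj (KőnigWitness.matching W₁) u x in ux∈N₁
... | false | _     = rizziWitness H uv∈H uw∈H (w≢v ∘ sym) W₁ uw∈N₁ (W₂ w uw∈H)
... | true  | false = rizziWitness H uv∈H ux∈H (x≢v ∘ sym) W₁ ux∈N₁ (W₂ x ux∈H)
... | true  | true  = ⊥-elim (x≢w (sym (KőnigWitness.unique W₁ u w x uw∈N₁ ux∈N₁)))

removeVertex-bipartite : (H : Graph n) (v : Fin n) → Bipartite H → Bipartite (removeVertex H v)
removeVertex-bipartite H v = ⊆G-bipartite {H′ = removeVertex H v} {H} (removeVertex-⊆G H v)

removeEdge-bipartite : (H : Graph n) (a b : Fin n) → Bipartite H → Bipartite (removeEdge H a b)
removeEdge-bipartite H a b = ⊆G-bipartite {H′ = removeEdge H a b} {H} (removeEdge-⊆G H a b)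

neighbours-sameColour : {H : Graph n} ((c , proper) : Bipartite H) {u v w : Fin n} →
                        adj H u v ≡ true → adj H u w ≡ true → c v ≡ c w
neighbours-sameColour (c , proper) {u} {v} {w} uv∈H uw∈H =
  trans (¬-not (proper u v uv∈H ∘ sym)) (sym (¬-not (proper u w uw∈H ∘ sym)))

twoNeighboursWitness : (H : Graph n) → Bipartite H → {u v w : Fin n} → adj H u v ≡ true → adj H u w ≡ true → v ≢ w →
                       (∀ j → adj H u j ≡ true → j ≡ v ⊎ j ≡ w) →
                       (Bipartite (contract H u v w) → KőnigWitness (contract H u v w)) → KőnigWitness H
twoNeighboursWitness H bip@(c , proper) {u} {v} {w} uv∈H uw∈H v≢w only-v-w W =
  contractWitness H uv∈H uw∈H v≢w wv∉H only-v-w (W (c , contract-properColouring H c proper cv≡cw))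
  where
  cv≡cw = neighbours-sameColour {H = H} bip uv∈H uw∈H
  wv∉H : adj H w v ≡ false
  wv∉H with adj H w v in wv∈H
  ... | false = refl
  ... | true  = ⊥-elim (proper w v wv∈H (sym cv≡cw))

kőnig-step : (H : Graph n) → (∀ {H′} → H′ ⊏ H → Bipartite H′ → KőnigWitness H′) → Bipartite H → KőnigWitness H
kőnig-step H rec bip with any? (hasNeighbour? H)
... | no edgeless = edgelessWitness H (λ u → noEdge⇒isolated H (λ j uj∈H → edgeless (u , j , uj∈H)))
... | yes (u , v , uv∈H) with any? (λ w → (adj H u w Bool.≟ true) ×-dec ¬? (w ≟ v))
...   | no only-v = leafWitness H uv∈H neighbour≡v
                      (rec (removeVertex-⊏ H uv∈H) (removeVertex-bipartite H v bip))
  where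
  neighbour≡v : ∀ j → adj H u j ≡ true → j ≡ v
  neighbour≡v j uj∈H with j ≟ v
  ... | yes j≡v = j≡v
  ... | no j≢v  = ⊥-elim (only-v (j , uj∈H , j≢v))
...   | yes (w , uw∈H , w≢v) with any? (λ x → (adj H u x Bool.≟ true) ×-dec (¬? (x ≟ v) ×-dec ¬? (x ≟ w)))
...     | no only-v-w =
  twoNeighboursWitness H bip uv∈H uw∈H (w≢v ∘ sym) neighbour∈vw (rec (contract-⊏ H uv∈H))
  where
  neighbour∈vw : ∀ j → adj H u j ≡ true → j ≡ v ⊎ j ≡ w
  neighbour∈vw j uj∈H with j ≟ v | j ≟ w
  ... | yes j≡v | _       = inj₁ j≡v
  ... | no _    | yes j≡w = inj₂ j≡w
  ... | no j≢v  | no j≢w  = ⊥-elim (only-v-w (j , uj∈H , j≢v , j≢w))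
...     | yes (x , ux∈H , x≢v , x≢w) =
  threeNeighboursWitness H uv∈H uw∈H ux∈H w≢v x≢v x≢w
    (rec (removeVertex-⊏ H uv∈H) (removeVertex-bipartite H v bip))
    (λ t ut∈H → rec (removeEdge-⊏ H ut∈H) (removeEdge-bipartite H u t bip))

kőnig : (H : Graph n) → Bipartite H → KőnigWitness H
kőnig = All.wfRec ⊏-wellFounded _ (λ H → Bipartite H → KőnigWitness H) kőnig-step

-- Peeling off maximum matchings

residual-⊆G : (G : Graph n) (Ms : List (Graph n)) → residual G Ms ⊆G G
residual-⊆G G []       i j ij∈R = ij∈R
residual-⊆G G (M ∷ Ms) i j ij∈R with adj G i j | residual-⊆G (deleteEdges G M) Ms i j ij∈R
... | true | _ = refl

totalEdges : List (Graph n) → ℕ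
totalEdges Ms = List.sum (map numEdges Ms)

peeling-matchingBound : {G : Graph n} {Ms : List (Graph n)} → Peeling G Ms →
                        (N : Graph n) → IsMatching (residual G Ms) N → length Ms * numEdges N ≤ totalEdges Ms
peeling-matchingBound done N _ = z≤n
peeling-matchingBound {G = G} {M ∷ Ms} (step (_ , maximum) peeling) N (N⊆R , degree≤1) =
  +-mono-≤ (maximum N (⊆G-trans {M = N} {residual (deleteEdges G M) Ms} {G} N⊆R (residual-⊆G G (M ∷ Ms)) ,
                       degree≤1))
           (peeling-matchingBound peeling N (N⊆R , degree≤1))

multiplicity : List (Graph n) → Fin n → Fin n → ℕ
multiplicity Ms i j = List.sum (map (λ M → 𝟙 (adj M i j)) Ms)

multiplicity-sym : (Ms : List (Graph n)) (i j : Fin n) → multiplicity Ms i j ≡ multiplicity Ms j i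
multiplicity-sym []       i j = refl
multiplicity-sym (M ∷ Ms) i j = cong₂ _+_ (cong 𝟙 (Graph.sym M i j)) (multiplicity-sym Ms i j)

unionAdj-sym : (Ms : List (Graph n)) (i j : Fin n) → unionAdj Ms i j ≡ unionAdj Ms j i
unionAdj-sym []       i j = refl
unionAdj-sym (M ∷ Ms) i j = cong₂ _∨_ (Graph.sym M i j) (unionAdj-sym Ms i j)

peeling-degree : {G : Graph n} {Ms : List (Graph n)} → Peeling G Ms →
                 ∀ i → ∑[ j < n ] multiplicity Ms i j ≤ length Ms
peeling-degree {n} done i = ≤-reflexive (sum-replicate-zero n)
peeling-degree {n} {Ms = M ∷ Ms} (step ((_ , degree≤1) , _) peeling) i = begin
  ∑[ j < n ] (𝟙 (adj M i j) + multiplicity Ms i j)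
    ≡⟨ ∑-distrib-+ (λ j → 𝟙 (adj M i j)) (multiplicity Ms i) ⟩
  count (adj M i) + ∑[ j < n ] multiplicity Ms i j
    ≤⟨ +-mono-≤ (subst (_≤ 1) (countV≡count (adj M i)) (degree≤1 i)) (peeling-degree peeling i) ⟩
  suc (length Ms) ∎
  where open ≤-Reasoning

peeling-disjoint : {G : Graph n} {Ms : List (Graph n)} → Peeling G Ms →
                   ∀ i j → multiplicity Ms i j + 𝟙 (adj G i j ∧ not (unionAdj Ms i j)) ≤ 𝟙 (adj G i j)
peeling-disjoint {G = G} done i j rewrite ∧-identityʳ (adj G i j) = ≤-refl
peeling-disjoint {G = G} {M ∷ Ms} (step ((M⊆G , _) , _) peeling) i j
  with adj G i j in ij∈G | adj M i j in ij∈M | peeling-disjoint peeling i j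
... | true  | true  | bound = s≤s bound
... | true  | false | bound = bound
... | false | false | bound = bound
... | false | true  | _     = ⊥-elim (false≢true (trans (sym ij∈G) (M⊆G i j ij∈M)))

countOrdered-multiplicity : (Ms : List (Graph n)) → ∑[ i < n ] ∑[ j < n ] multiplicity Ms i j ≡ 2 * totalEdges Ms
countOrdered-multiplicity {n} [] = begin
  ∑[ i < n ] ∑[ j < n ] 0 ≡⟨ sum-cong-≗ {n} (λ _ → sum-replicate-zero n) ⟩
  ∑[ i < n ] 0            ≡⟨ sum-replicate-zero n ⟩
  0                       ∎
  where open ≡-Reasoning
countOrdered-multiplicity {n} (M ∷ Ms) = begin
  ∑[ i < n ] ∑[ j < n ] (𝟙 (adj M i j) + multiplicity Ms i j)
    ≡⟨ ∑∑-distrib-+ (λ i j → 𝟙 (adj M i j)) (multiplicity Ms) ⟩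
  countOrdered (adj M) + ∑[ i < n ] ∑[ j < n ] multiplicity Ms i j
    ≡⟨ cong₂ _+_ (handshake M) (countOrdered-multiplicity Ms) ⟩
  2 * numEdges M + 2 * totalEdges Ms
    ≡⟨ sym (*-distribˡ-+ 2 (numEdges M) (totalEdges Ms)) ⟩
  2 * totalEdges (M ∷ Ms) ∎
  where open ≡-Reasoning

module DoubleCounting {G : Graph n} {Ms : List (Graph n)} (peeling : Peeling G Ms) (s : Fin n → Bool)
                      (kDependent : ∀ v → s v ≡ true → count (λ j → s j ∧ adj G v j) ≤ length Ms) where

  K = length Ms

  outsideEdge : Fin n → Fin n → Bool
  outsideEdge i j = s i ∧ s j ∧ adj G i j ∧ not (unionAdj Ms i j)

  crossing : Fin n → Fin n → ℕ
  crossing i j = if s i ∧ not (s j) then multiplicity Ms i j else 0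

  row-bound : ∀ i → count (outsideEdge i) + ∑[ j < n ] multiplicity Ms i j ≤ K + ∑[ j < n ] crossing i j
  row-bound i = by-cases (s i) refl
    where
    open ≤-Reasoning
    -- an edge from i ∈ s to j ∉ s is charged to the crossing term instead of the degree of i in G[s]
    charge : s i ≡ true → ∀ j → 𝟙 (outsideEdge i j) + multiplicity Ms i j ≤ 𝟙 (s j ∧ adj G i j) + crossing i j
    charge si j rewrite si with s j | peeling-disjoint peeling i j
    ... | true  | bound = ≤-trans (≤-reflexive (+-comm _ (multiplicity Ms i j))) (≤-trans bound (m≤m+n _ 0))
    ... | false | _     = ≤-refl
    no-outside-edge : s i ≡ false → count (outsideEdge i) ≡ 0
    no-outside-edge si = trans (sum-cong-≗ {n} (λ j → cong (λ b → 𝟙 (b ∧ s j ∧ adj G i j ∧ not (unionAdj Ms i j))) si))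
                               (sum-replicate-zero n)
    by-cases : ∀ b → s i ≡ b → count (outsideEdge i) + ∑[ j < n ] multiplicity Ms i j ≤ K + ∑[ j < n ] crossing i j
    by-cases false si = begin
      count (outsideEdge i) + ∑[ j < n ] multiplicity Ms i j
        ≡⟨ cong (_+ ∑[ j < n ] multiplicity Ms i j) (no-outside-edge si) ⟩
      ∑[ j < n ] multiplicity Ms i j
        ≤⟨ peeling-degree peeling i ⟩
      K
        ≤⟨ m≤m+n K _ ⟩
      K + ∑[ j < n ] crossing i j ∎
    by-cases true si = begin
      count (outsideEdge i) + ∑[ j < n ] multiplicity Ms i j
        ≡⟨ sym (∑-distrib-+ (𝟙 ∘ outsideEdge i) (multiplicity Ms i)) ⟩
      ∑[ j < n ] (𝟙 (outsideEdge i j) + multiplicity Ms i j)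
        ≤⟨ ∑-mono-≤ (charge si) ⟩
      ∑[ j < n ] (𝟙 (s j ∧ adj G i j) + crossing i j)
        ≡⟨ ∑-distrib-+ (λ j → 𝟙 (s j ∧ adj G i j)) (crossing i) ⟩
      count (λ j → s j ∧ adj G i j) + ∑[ j < n ] crossing i j
        ≤⟨ +-monoˡ-≤ _ (kDependent i si) ⟩
      K + ∑[ j < n ] crossing i j ∎

  crossing-bound : ∑[ i < n ] ∑[ j < n ] crossing i j ≤ K * count (not ∘ s)
  crossing-bound = begin
    ∑[ i < n ] ∑[ j < n ] crossing i j
      ≡⟨ ∑-comm crossing ⟩
    ∑[ j < n ] ∑[ i < n ] crossing i j
      ≤⟨ ∑-mono-≤ (λ j → ∑-mono-≤ (λ i → drop-si (s i) (not (s j)))) ⟩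
    ∑[ j < n ] ∑[ i < n ] (if not (s j) then multiplicity Ms i j else 0)
      ≡⟨ sum-cong-≗ (λ j → ∑-if (not (s j)) (λ i → multiplicity Ms i j)) ⟩
    ∑[ j < n ] (if not (s j) then ∑[ i < n ] multiplicity Ms i j else 0)
      ≤⟨ ∑-mono-≤ (λ j → at-most-K (not (s j)) (column-bound j)) ⟩
    ∑[ j < n ] (K * 𝟙 (not (s j)))
      ≡⟨ sym (*-distribˡ-sum K (𝟙 ∘ not ∘ s)) ⟩
    K * count (not ∘ s) ∎
    where
    open ≤-Reasoning
    drop-si : ∀ a b {x} → (if a ∧ b then x else 0) ≤ (if b then x else 0)
    drop-si true  _     = ≤-refl
    drop-si false true  = z≤n
    drop-si false false = ≤-refl
    column-bound : ∀ j → ∑[ i < n ] multiplicity Ms i j ≤ K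
    column-bound j = subst (_≤ K) (sum-cong-≗ (λ i → multiplicity-sym Ms j i)) (peeling-degree peeling j)
    at-most-K : ∀ b {x} → x ≤ K → (if b then x else 0) ≤ K * 𝟙 b
    at-most-K true  x≤K = ≤-trans x≤K (≤-reflexive (sym (*-identityʳ K)))
    at-most-K false _   = z≤n

  outsideEdge-sym : ∀ i j → outsideEdge i j ≡ outsideEdge j i
  outsideEdge-sym i j rewrite Graph.sym G i j | unionAdj-sym Ms i j with s i | s j
  ... | true  | true  = refl
  ... | true  | false = refl
  ... | false | true  = refl
  ... | false | false = refl

  outsideEdge-irrefl : ∀ i → outsideEdge i i ≡ false
  outsideEdge-irrefl i rewrite irrefl G i with s i
  ... | true  = refl
  ... | false = refl

  doubleCount : K * count s + 2 * countPairs outsideEdge + 2 * totalEdges Ms ≤ 2 * K * n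
  doubleCount = begin
    K * count s + 2 * countPairs outsideEdge + 2 * totalEdges Ms
      ≡⟨ +-assoc (K * count s) _ _ ⟩
    K * count s + (2 * countPairs outsideEdge + 2 * totalEdges Ms)
      ≡⟨ cong (K * count s +_) (sym (cong₂ _+_ (countOrdered≡2*countPairs outsideEdge outsideEdge-sym outsideEdge-irrefl)
                                               (countOrdered-multiplicity Ms))) ⟩
    K * count s + (countOrdered outsideEdge + ∑[ i < n ] ∑[ j < n ] multiplicity Ms i j)
      ≡⟨ cong (K * count s +_)
              (sym (∑-distrib-+ (λ i → count (outsideEdge i)) (λ i → ∑[ j < n ] multiplicity Ms i j))) ⟩
    K * count s + ∑[ i < n ] (count (outsideEdge i) + ∑[ j < n ] multiplicity Ms i j)
      ≤⟨ +-monoʳ-≤ (K * count s) (∑-mono-≤ row-bound) ⟩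
    K * count s + ∑[ i < n ] (K + ∑[ j < n ] crossing i j)
      ≡⟨ cong (K * count s +_) (trans (∑-distrib-+ (λ _ → K) (λ i → ∑[ j < n ] crossing i j))
                                      (cong (_+ ∑[ i < n ] ∑[ j < n ] crossing i j) (∑-const n K))) ⟩
    K * count s + (n * K + ∑[ i < n ] ∑[ j < n ] crossing i j)
      ≤⟨ +-monoʳ-≤ (K * count s) (+-monoʳ-≤ (n * K) crossing-bound) ⟩
    K * count s + (n * K + K * count (not ∘ s))
      ≡⟨ regroup K (count s) (count (not ∘ s)) n (count-complement s) ⟩
    2 * K * n ∎
    where
    open ≤-Reasoning
    regroup : ∀ k a b m → a + b ≡ m → k * a + (m * k + k * b) ≡ 2 * k * m
    regroup k a b _ refl = solve 3 (λ k a b → k :* a :+ ((a :+ b) :* k :+ k :* b) := con 2 :* k :* (a :+ b)) refl k a b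
      where open +-*-Solver

∣∣≡count : (S : Subset n) → ∣ S ∣ ≡ count (Vec.lookup S)
∣∣≡count []          = refl
∣∣≡count (true  ∷ S) = cong suc (∣∣≡count S)
∣∣≡count (false ∷ S) = ∣∣≡count S

n≤cover+independent : {H : Graph n} {C : Fin n → Bool} → Covers H C → (I : Subset n) → IsMaximumIndependent H I →
                    n ≤ count C + ∣ I ∣
n≤cover+independent {n} {H} {C} covers I (_ , maximum) = begin
  n                         ≡⟨ sym (count-complement C) ⟩
  count C + count (not ∘ C) ≡⟨ cong (count C +_) (sym ∣uncovered∣) ⟩
  count C + ∣ uncovered ∣   ≤⟨ +-monoʳ-≤ (count C) (maximum uncovered uncovered-independent) ⟩
  count C + ∣ I ∣           ∎
  where
  open ≤-Reasoning
  uncovered : Subset n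
  uncovered = Vec.tabulate (not ∘ C)
  ∣uncovered∣ : ∣ uncovered ∣ ≡ count (not ∘ C)
  ∣uncovered∣ = trans (∣∣≡count uncovered) (sum-cong-≗ (λ i → cong 𝟙 (lookup∘tabulate (not ∘ C) i)))
  not-covered : ∀ {i} → i ∈ uncovered → not (C i) ≡ true
  not-covered {i} i∈ = trans (sym (lookup∘tabulate (not ∘ C) i)) ([]=⇒lookup i∈)
  uncovered-independent : IsIndependent H uncovered
  uncovered-independent i j i∈ j∈ with adj H i j in ij∈H
  ... | false = refl
  ... | true with covers i j ij∈H
  ...   | inj₁ Ci = ⊥-elim (false≢true (trans (sym (cong not Ci)) (not-covered i∈)))
  ...   | inj₂ Cj = ⊥-elim (false≢true (trans (sym (cong not Cj)) (not-covered j∈)))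

cancel-matchingEdges : ∀ k a e t c ι m → k * a + 2 * e + 2 * t ≤ 2 * k * m → m ≤ c + ι → k * c ≤ t →
                       k * a + 2 * e ≤ 2 * k * ι
cancel-matchingEdges k a e t c ι m counted m≤c+ι kc≤t = +-cancelʳ-≤ (2 * t) (k * a + 2 * e) (2 * k * ι) (begin
  k * a + 2 * e + 2 * t   ≤⟨ counted ⟩
  2 * k * m               ≤⟨ *-monoʳ-≤ (2 * k) m≤c+ι ⟩
  2 * k * (c + ι)         ≡⟨ *-distribˡ-+ (2 * k) c ι ⟩
  2 * k * c + 2 * k * ι   ≡⟨ cong (_+ 2 * k * ι) (*-assoc 2 k c) ⟩
  2 * (k * c) + 2 * k * ι ≤⟨ +-monoˡ-≤ (2 * k * ι) (*-monoʳ-≤ 2 kc≤t) ⟩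
  2 * t + 2 * k * ι       ≡⟨ +-comm (2 * t) (2 * k * ι) ⟩
  2 * k * ι + 2 * t       ∎)
  where open ≤-Reasoning

lemma2 : (n k : ℕ) → 1 ≤ k → (G : Graph n) → Bipartite G
       → (Ms : List (Graph n)) → length Ms ≡ k → Peeling G Ms
       → (I : Subset n) → IsMaximumIndependent (residual G Ms) I
       → (Istar : Subset n) → IsMaximumKDependent k G Istar
       → k * ∣ Istar ∣ + 2 * numEdgesOutside G Istar Ms ≤ 2 * k * ∣ I ∣
lemma2 n .(length Ms) _ G bipartite Ms refl peeling I I-maximum Istar (Istar-kDependent , _) =
  cancel-matchingEdges K (∣ Istar ∣) (numEdgesOutside G Istar Ms) (totalEdges Ms) (count cover) (∣ I ∣) n
    (subst (λ a → K * a + 2 * numEdgesOutside G Istar Ms + 2 * totalEdges Ms ≤ 2 * K * n)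
           (sym (∣∣≡count Istar)) doubleCount)
    (n≤cover+independent {H = residual G Ms} covers I I-maximum)
    (≤-trans (*-monoʳ-≤ K cover≤matching) (peeling-matchingBound peeling matching (matching⊆H , degree≤1)))
  where
  K = length Ms
  open KőnigWitness (kőnig (residual G Ms) (⊆G-bipartite {H′ = residual G Ms} {G} (residual-⊆G G Ms) bipartite))
  degree≤1 : ∀ v → degree matching v ≤ 1
  degree≤1 v = subst (_≤ 1) (sym (countV≡count (adj matching v)))
                     (uniqueNeighbours⇒count≤1 {M = matching} unique v)
  kDependent : ∀ v → Vec.lookup Istar v ≡ true → count (λ j → Vec.lookup Istar j ∧ adj G v j) ≤ K
  kDependent v v∈Istar = subst (_≤ K) (countV≡count (λ j → Vec.lookup Istar j ∧ adj G v j))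
                                (Istar-kDependent v (lookup⇒[]= v Istar v∈Istar))
  open DoubleCounting peeling (Vec.lookup Istar) kDependent using (doubleCount)
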